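{- Assume that $d_n^2 < 2p_{n+1}$ for every integer $n\geq 1$. Then for every integer $N\geq 1$ there is a prime $p$ with $N^2 < p < (N+1)^2$.
   Context: $p_n$ denotes the $n$th prime ($p_1=2$) and $d_n := p_{n+1}-p_n$. -}

module Defs where

open import Data.Nat using (ℕ; zero; suc; _+_)
open import Data.Nat.Primality using (Prime; prime?)
open import Data.Product using (_×_)
open import Relation.Binary.PropositionalEquality using (_≡_)
open import Relation.Nullary using (yes; no)

primeCount : ℕ → ℕ
primeCount zero = 0
primeCount (suc x) with prime? (suc x)
... | yes _ = suc (primeCount x)
... | no  _ = primeCount x

-- NthPrime n q  :  q = p_n, the n-th prime (1-indexed, p_1 = 2)
NthPrime : ℕ → ℕ → Set
NthPrime n q = Prime q × primeCount q ≡ n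

{-# OPTIONS --safe #-}
-- Let p be the largest prime ≤ N², i.e. p = p_n for n = π(N²), and q = p_{n+1} the next
-- one, so q > N². For N ≥ 2 the square N² is not prime, so p < N². If q ≥ (N+1)² then
-- d = q − p ≥ 2N + 2, whence d² ≥ (2N + 2)d > 2p + 2d = 2q, against the hypothesis.
-- Euclid's argument supplies q.

module Submission where

open import Defs
open import Data.Nat using (ℕ; suc; _+_; _*_; _∸_; _≤_; _<_)
open import Data.Nat.Primality using (Prime)
open import Data.Product using (_×_; ∃-syntax)

open import Data.Nat.Base
  using (zero; z≤n; s≤s; _≤′_; ≤′-refl; ≤′-step; _≰_; _!; NonZero; NonTrivial
        ; n>1⇒nonTrivial; nonTrivial⇒nonZero; nonTrivial⇒n>1; nonTrivial⇒≢1)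
open import Data.Nat.Properties
open import Data.Nat.Divisibility using (_∣_; ∣-trans; m∣m*n; m≤n⇒m!∣n!; ∣m+n∣m⇒∣n; ∣1⇒≡1)
open import Data.Nat.Primality
  using (prime?; prime[2]; ¬prime[1]; ¬prime[0]; prime⇒nonZero; composite-≢; composite⇒¬prime)
open import Data.Nat.Primality.Factorisation using (factorise)
open import Data.Nat.ListAction using (product)
open import Data.List.Base using ([]; _∷_)
open import Data.List.Relation.Unary.All using (_∷_)
open import Data.Product using (_,_; proj₁; proj₂; map₁; map₂; ∃₂)
open import Data.Sum using (inj₁; inj₂)
open import Relation.Nullary using (¬_; yes; no; contradiction)
open import Relation.Binary.PropositionalEquality using (_≡_; refl; sym; cong; subst)
open import Data.Nat.Tactic.RingSolver using (solve-∀)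

∣n! : ∀ {m n} → .{{NonZero m}} → m ≤ n → m ∣ n !
∣n! {suc m} m≤n = ∣-trans (m∣m*n (m !)) (m≤n⇒m!∣n! m≤n)

∃-prime-∣ : ∀ n → .{{NonTrivial n}} → ∃[ p ] (Prime p × p ∣ n)
∃-prime-∣ n with factorise n {{nonTrivial⇒nonZero n}}
... | record { factors = [] ; isFactorisation = n≡1 } = contradiction n≡1 nonTrivial⇒≢1
... | record { factors = p ∷ ps ; isFactorisation = refl ; factorsPrime = prime[p] ∷ _ } =
  p , prime[p] , m∣m*n (product ps)

∃-prime-> : ∀ x → ∃[ p ] (Prime p × x < p)
∃-prime-> x with ∃-prime-∣ (x ! + 1) {{n>1⇒nonTrivial (+-monoˡ-≤ 1 (1≤n! x))}}
... | p , prime[p] , p∣x!+1 = p , prime[p] , ≰⇒> p≰x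
  where
  p≰x : p ≰ x
  p≰x p≤x = ¬prime[1] (subst Prime (∣1⇒≡1 p∣1) prime[p])
    where
    p∣1 : p ∣ 1
    p∣1 = ∣m+n∣m⇒∣n p∣x!+1 (∣n! {{prime⇒nonZero prime[p]}} p≤x)

¬prime-square : ∀ n → .{{NonTrivial n}} → ¬ Prime (n * n)
¬prime-square n = composite⇒¬prime (composite-≢ n (<⇒≢ (m<m*n n n (nonTrivial⇒n>1 n))) (m∣m*n n))
  where instance
    _ = nonTrivial⇒nonZero n
    _ = m*n≢0 n n

primeCount-suc-prime : ∀ {x} → Prime (suc x) → primeCount (suc x) ≡ suc (primeCount x)
primeCount-suc-prime {x} prime[1+x] with prime? (suc x)
... | yes _ = refl
... | no ¬prime[1+x] = contradiction prime[1+x] ¬prime[1+x]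

primeCount-≤-suc : ∀ x → primeCount x ≤ primeCount (suc x)
primeCount-≤-suc x with prime? (suc x)
... | yes _ = n≤1+n (primeCount x)
... | no _ = ≤-refl

primeCount-mono-≤ : ∀ {m n} → m ≤ n → primeCount m ≤ primeCount n
primeCount-mono-≤ m≤n = go (≤⇒≤′ m≤n)
  where
  go : ∀ {m n} → m ≤′ n → primeCount m ≤ primeCount n
  go ≤′-refl = ≤-refl
  go (≤′-step {n} m≤′n) = ≤-trans (go m≤′n) (primeCount-≤-suc n)

primeCount-cancel-< : ∀ {m n} → primeCount m < primeCount n → m < n
primeCount-cancel-< πm<πn = ≰⇒> (λ n≤m → <⇒≱ πm<πn (primeCount-mono-≤ n≤m))

primeCount-<-prime : ∀ {x p} → x < p → Prime p → primeCount x < primeCount p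
primeCount-<-prime {p = zero} _ prime[0] = contradiction prime[0] ¬prime[0]
primeCount-<-prime {x} {suc p} (s≤s x≤p) prime[p] = begin-strict
  primeCount x          ≤⟨ primeCount-mono-≤ x≤p ⟩
  primeCount p          <⟨ n<1+n (primeCount p) ⟩
  suc (primeCount p)    ≡⟨ primeCount-suc-prime prime[p] ⟨
  primeCount (suc p)    ∎
  where open ≤-Reasoning

nthPrime-≤ : ∀ x {n} → 1 ≤ n → n ≤ primeCount x → ∃[ p ] (p ≤ x × NthPrime n p)
nthPrime-≤ zero 1≤n n≤0 = contradiction (≤-trans 1≤n n≤0) λ ()
nthPrime-≤ (suc x) 1≤n n≤π with prime? (suc x)
... | no _ = map₂ (map₁ m≤n⇒m≤1+n) (nthPrime-≤ x 1≤n n≤π)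
... | yes prime[1+x] with m≤n⇒m<n∨m≡n n≤π
...   | inj₁ (s≤s n≤πx) = map₂ (map₁ m≤n⇒m≤1+n) (nthPrime-≤ x 1≤n n≤πx)
...   | inj₂ refl = suc x , ≤-refl , prime[1+x] , primeCount-suc-prime prime[1+x]

nthPrime-around : ∀ x → 1 ≤ primeCount x →
  ∃₂ λ p q → p ≤ x × x < q × NthPrime (primeCount x) p × NthPrime (suc (primeCount x)) q
nthPrime-around x 1≤π with nthPrime-≤ x 1≤π ≤-refl | ∃-prime-> x
... | p , p≤x , p-nth | Q , prime[Q] , x<Q with nthPrime-≤ Q (s≤s z≤n) (primeCount-<-prime x<Q prime[Q])
...   | q , _ , q-nth =
  p , q , p≤x , primeCount-cancel-< (≤-reflexive (sym (proj₂ q-nth))) , p-nth , q-nth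

gap-across-square : ∀ N p q → p < N * N → suc N * suc N ≤ q → 2 * q ≤ (q ∸ p) * (q ∸ p)
gap-across-square N p q p<N² [N+1]²≤q = begin
  2 * q                 ≡⟨ cong (2 *_) q≡p+d ⟩
  2 * (p + d)           ≡⟨ *-distribˡ-+ 2 p d ⟩
  2 * p + 2 * d         ≤⟨ +-monoˡ-≤ (2 * d) (*-monoʳ-≤ 2 p≤N*d) ⟩
  2 * (N * d) + 2 * d   ≡⟨ +-comm (2 * (N * d)) (2 * d) ⟩
  2 * d + 2 * (N * d)   ≡⟨ cong (2 * d +_) (*-assoc 2 N d) ⟨
  2 * d + 2 * N * d     ≡⟨ *-distribʳ-+ d 2 (2 * N) ⟨
  (2 + 2 * N) * d       ≤⟨ *-monoˡ-≤ d 2+2N≤d ⟩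
  d * d                 ∎
  where
  open ≤-Reasoning
  d = q ∸ p
  square-suc : ∀ N → suc N * suc N ≡ N * N + (1 + 2 * N)
  square-suc = solve-∀
  p≤q : p ≤ q
  p≤q = ≤-trans (<⇒≤ p<N²) (≤-trans (*-mono-≤ (n≤1+n N) (n≤1+n N)) [N+1]²≤q)
  q≡p+d : q ≡ p + d
  q≡p+d = sym (m+[n∸m]≡n p≤q)
  2+2N≤d : 2 + 2 * N ≤ d
  2+2N≤d = +-cancelˡ-≤ p (2 + 2 * N) d (begin
    p + (2 + 2 * N)       ≡⟨ +-suc p (1 + 2 * N) ⟩
    suc p + (1 + 2 * N)   ≤⟨ +-monoˡ-≤ (1 + 2 * N) p<N² ⟩
    N * N + (1 + 2 * N)   ≡⟨ square-suc N ⟨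
    suc N * suc N         ≤⟨ [N+1]²≤q ⟩
    q                     ≡⟨ q≡p+d ⟩
    p + d                 ∎)
  p≤N*d : p ≤ N * d
  p≤N*d = ≤-trans (<⇒≤ p<N²) (*-monoʳ-≤ N N≤d)
    where
    N≤d : N ≤ d
    N≤d = ≤-trans (m≤n*m N 2) (≤-trans (m≤n+m (2 * N) 2) 2+2N≤d)

theorem2p3 : (∀ n p q → 1 ≤ n → NthPrime n p → NthPrime (suc n) q →
    (q ∸ p) * (q ∸ p) < 2 * q) →
    ∀ N → 1 ≤ N →
    ∃[ r ] (Prime r × N * N < r × r < suc N * suc N)
theorem2p3 gaps² (suc zero) _ = 2 , prime[2] , s≤s (s≤s z≤n) , s≤s (s≤s (s≤s z≤n))
theorem2p3 gaps² N@(suc (suc _)) _ with primeCount-mono-≤ {2} {N * N} (s≤s (s≤s z≤n))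
... | 1≤π with nthPrime-around (N * N) 1≤π
... | p , q , p≤N² , N²<q , p-nth , q-nth with q <? suc N * suc N
...   | yes q<[N+1]² = q , proj₁ q-nth , N²<q , q<[N+1]²
...   | no q≮[N+1]² =
  contradiction (gaps² _ p q 1≤π p-nth q-nth) (≤⇒≯ (gap-across-square N p q p<N² (≮⇒≥ q≮[N+1]²)))
  where
  p<N² : p < N * N
  p<N² = ≤∧≢⇒< p≤N² (λ p≡N² → ¬prime-square N (subst Prime p≡N² (proj₁ p-nth)))
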